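{- In the setting described in the context, let $X$ be an $M$-$M^*$-path. Then at least one endpoint of $X$ is not isolated in the current graph at the end of the step in which the first $M$-edge of $X$ is added to $M$. Moreover, let $w$ be an endpoint of $X$ that is not isolated at the end of that step, and let $s$ be the later step at the end of which $w$ becomes isolated. If at the beginning of step $s$ the node $w$ is not incident with its $M^*$-edge, then one of the edges incident with $w$ at the beginning of step $s$ is a direct transfer (so $w$ receives a direct credit).
   Context: Let $\Delta\ge 4$ and let $G=(V,E)$ be a finite simple graph with all degrees at most $\Delta$. A min-degree greedy algorithm proceeds in steps on a current graph (initially $G$): in each step, if the current graph has an edge, it chooses a node $u$ of minimum degree among the non-isolated nodes of the current graph, chooses any neighbor $v$ of $u$ in the current graph, adds $\{u,v\}$ to $M$ (initially empty), and deletes $u$, $v$ and all their incident edges; otherwise it stops. Let $M$ be the resulting matching; $d(x)$ denotes degree in the current graph at the time referred to. Fix a maximum matching $M^*$ such that every connected component $X$ of $(V,M\cup M^*)$ with at least one edge is either a single edge of $M\cap M^*$, or a path of $m_X\ge1$ edges of $M$ and $m_X+1$ edges of $M^*$ alternating, with first and last edge in $M^*$ (an $M$-$M^*$-path; its end nodes are not covered by $M$). Let $F=E\setminus(M\cup M^*)$. A direct transfer is an edge $\{v,w\}\in F$ with $v$ covered by $M$ and $w$ an endpoint of an $M$-$M^*$-path such that, where $s$ is the step in which $v$ is deleted, (i) the edge added to $M$ in step $s$ is not the first $M$-edge added within any $M$-$M^*$-path, and (ii) $d(w)\le\Delta-2$ at the end of step $s$; it is a direct credit of $w$. -}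

module Defs where

open import Data.Nat using (ℕ; zero; suc; _≤_; _<_)
open import Data.Bool using (Bool; true; false; _∧_; _∨_; not; if_then_else_)
open import Data.Fin using (Fin; toℕ)
open import Data.Fin.Properties using (_≟_)
open import Data.List using (List; []; _∷_; _++_; length; take; lookup; allFin; map; concatMap)
open import Data.Nat.ListAction using (sum)
open import Data.List.Membership.Propositional using (_∈_)
open import Data.List.Relation.Unary.All using (All)
open import Data.List.Relation.Unary.Unique.Propositional using (Unique)
open import Data.Product using (Σ; ∃; _×_; _,_; proj₁; proj₂)
open import Data.Sum using (_⊎_)
open import Relation.Nullary using (¬_; does)
open import Relation.Binary.PropositionalEquality using (_≡_)
open import Relation.Binary.Construct.Closure.ReflexiveTransitive using (Star)

record Graph (n : ℕ) : Set where
  field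
    adj    : Fin n → Fin n → Bool
    sym    : ∀ x y → adj x y ≡ adj y x
    irrefl : ∀ x → adj x x ≡ false
open Graph public

-- A run of the greedy algorithm: the list of chosen pairs (u , v),
-- in the order of the steps.  Steps are indexed by Fin (length run)
-- (0-based).

Run : ℕ → Set
Run n = List (Fin n × Fin n)

isDel : ∀ {n} → Run n → Fin n → Bool
isDel []             x = false
isDel ((u , v) ∷ r)  x = (does (x ≟ u) ∨ does (x ≟ v)) ∨ isDel r x

cadj : ∀ {n} → Graph n → Run n → Fin n → Fin n → Bool
cadj G D x y = adj G x y ∧ (not (isDel D x) ∧ not (isDel D y))

deg : ∀ {n} → Graph n → Run n → Fin n → ℕ
deg {n} G D x = sum (map (λ y → if cadj G D x y then 1 else 0) (allFin n))

-- the steps performed before step s (current graph at the beginning of s)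
before : ∀ {n} (run : Run n) → Fin (length run) → Run n
before run s = take (toℕ s) run

-- the steps performed up to and including step s (end of step s)
after : ∀ {n} (run : Run n) → Fin (length run) → Run n
after run s = take (suc (toℕ s)) run

stepEdge : ∀ {n} (run : Run n) → Fin (length run) → Fin n × Fin n
stepEdge run s = lookup run s

InStep : ∀ {n} (run : Run n) → Fin (length run) → Fin n → Set
InStep run s x = x ≡ proj₁ (stepEdge run s) ⊎ x ≡ proj₂ (stepEdge run s)

record ValidRun {n} (G : Graph n) (run : Run n) : Set where
  field
    edgeChosen : ∀ s → cadj G (before run s) (proj₁ (stepEdge run s)) (proj₂ (stepEdge run s)) ≡ true
    minDegree  : ∀ s x → 0 < deg G (before run s) x →
                 deg G (before run s) (proj₁ (stepEdge run s)) ≤ deg G (before run s) x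
    terminated : ∀ x y → cadj G run x y ≡ false

-- The greedy matching M (given by the run) and the matching M*.

InM : ∀ {n} → Run n → Fin n → Fin n → Set
InM run x y = (x , y) ∈ run ⊎ (y , x) ∈ run

CoveredM : ∀ {n} → Run n → Fin n → Set
CoveredM run x = ∃ λ s → InStep run s x

-- a matching given as a list of edges (ordered pairs, orientation irrelevant)
endpoints : ∀ {n} → List (Fin n × Fin n) → List (Fin n)
endpoints = concatMap (λ p → proj₁ p ∷ proj₂ p ∷ [])

record IsMatching {n} (G : Graph n) (L : List (Fin n × Fin n)) : Set where
  field
    areEdges : All (λ p → adj G (proj₁ p) (proj₂ p) ≡ true) L
    disjoint : Unique (endpoints L)

IsMaximumMatching : ∀ {n} (G : Graph n) (L : List (Fin n × Fin n)) → Set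
IsMaximumMatching G L = IsMatching G L × (∀ L' → IsMatching G L' → length L' ≤ length L)

InMs : ∀ {n} → List (Fin n × Fin n) → Fin n → Fin n → Set
InMs L x y = (x , y) ∈ L ⊎ (y , x) ∈ L

InU : ∀ {n} → Run n → List (Fin n × Fin n) → Fin n → Fin n → Set
InU run L x y = InM run x y ⊎ InMs L x y

Reach : ∀ {n} → Run n → List (Fin n × Fin n) → Fin n → Fin n → Set
Reach run L = Star (InU run L)

data StarAlt {n} (run : Run n) (L : List (Fin n × Fin n)) : List (Fin n) → Set where
  lastEdge : ∀ {x y} → InMs L x y → StarAlt run L (x ∷ y ∷ [])
  moreEdges : ∀ {x y z rest} → InMs L x y → InM run y z → StarAlt run L (z ∷ rest) →
              StarAlt run L (x ∷ y ∷ z ∷ rest)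

-- an M-M*-path: a connected component of (V, M ∪ M*) which is a path
-- start, inner…, finish with m ≥ 1 edges of M and m+1 edges of M*
-- alternating, first and last edge in M*, end nodes not covered by M.
record MMsPath {n} (run : Run n) (L : List (Fin n × Fin n)) : Set where
  field
    start finish : Fin n
    inner        : List (Fin n)
  verts : List (Fin n)
  verts = start ∷ inner ++ finish ∷ []
  field
    alternating  : StarAlt run L verts
    atLeastOneM  : 2 ≤ length inner
    distinct     : Unique verts
    startFree    : ¬ CoveredM run start
    finishFree   : ¬ CoveredM run finish
    component    : ∀ y → (Reach run L start y → y ∈ verts) × (y ∈ verts → Reach run L start y)
open MMsPath public

IsEndpoint : ∀ {n} {run : Run n} {L} → MMsPath run L → Fin n → Set
IsEndpoint P w = w ≡ start P ⊎ w ≡ finish P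

ComponentStructure : ∀ {n} → Run n → List (Fin n × Fin n) → Set
ComponentStructure {n} run L =
  ∀ x y → InU run L x y →
    (InM run x y × InMs L x y × (∀ z → (Reach run L x z → (z ≡ x ⊎ z ≡ y)) × ((z ≡ x ⊎ z ≡ y) → Reach run L x z)))
    ⊎ (Σ (MMsPath run L) λ P → x ∈ verts P)

EdgeWithin : ∀ {n} {run : Run n} {L} → MMsPath run L → Fin (length run) → Set
EdgeWithin {run = run} P s = proj₁ (stepEdge run s) ∈ verts P × proj₂ (stepEdge run s) ∈ verts P

IsFirstMStep : ∀ {n} {run : Run n} {L} → MMsPath run L → Fin (length run) → Set
IsFirstMStep P s = EdgeWithin P s × (∀ s' → toℕ s' < toℕ s → ¬ EdgeWithin P s')

InF : ∀ {n} → Graph n → Run n → List (Fin n × Fin n) → Fin n → Fin n → Set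
InF G run L v w = adj G v w ≡ true × ¬ InM run v w × ¬ InMs L v w

DirectTransfer : ∀ {n} → Graph n → ℕ → Run n → List (Fin n × Fin n) → Fin n → Fin n → Set
DirectTransfer G Δ run L v w =
  InF G run L v w ×
  CoveredM run v ×
  (Σ (MMsPath run L) λ P → IsEndpoint P w) ×
  (Σ (Fin (length run)) λ s →
     InStep run s v ×
     (∀ (P : MMsPath run L) → ¬ IsFirstMStep P s) ×
     deg G (after run s) w ≤ Δ Data.Nat.∸ 2)

module Submission where

-- Everything rests on the min-degree rule.  Suppose step s deletes the edge u v and a non-isolated
-- node d ∉ {u, v} has all its current neighbours in {u, v}.  Then deg d ≤ 1 + [d ~ u], while
-- deg u ≥ 2 + [d ~ u] as soon as u has a neighbour c ∉ {v, d}; since u has minimum degree,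
-- N(u) ⊆ {v, d}.  If s adds the first M-edge of an M-M*-path P, then u is an inner node of P and
-- its M*-partner x ∈ P is still present and differs from v, so no such d ≠ x exists.  Hence the
-- endpoint of P other than x is not isolated by step s.  And if an endpoint w of P is isolated by
-- a later step s, then s adds the first M-edge of no path P′: either w ∈ P′, so P′ = P, whose first
-- M-edge came earlier, or w ∉ P′ and w ≠ x.  The edge from w to any neighbour deleted in step s is
-- then a direct transfer.

open import Defs hiding (sym)
open import Algebra.Properties.CommutativeSemigroup using (x∙yz≈y∙xz)
open import Data.Bool using (Bool; true; false; _∧_; _∨_; not; if_then_else_)
open import Data.Bool.Properties using (∨-zeroʳ; not-¬)
open import Data.Empty using (⊥-elim)
open import Data.Fin using (Fin; zero; suc; toℕ)
open import Data.Fin.Properties using (_≟_; toℕ-injective)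
open import Data.List using (List; []; _∷_; _∷ʳ_; length; take; map; allFin)
open import Data.List.Membership.Propositional using (_∈_)
import Data.List.Membership.DecPropositional as DecMembership
open import Data.List.Membership.Propositional.Properties using (∈-lookup; ∈-++⁺ʳ)
open import Data.List.Properties using (map-tabulate; ∷ʳ-injectiveʳ)
open import Data.List.Relation.Unary.All as All using (All; []; _∷_)
open import Data.List.Relation.Unary.AllPairs using ([]; _∷_)
open import Data.List.Relation.Unary.Any using (here; there; index)
open import Data.List.Relation.Unary.Any.Properties using (lookup-index)
open import Data.List.Relation.Unary.Unique.Propositional using (Unique)
open import Data.Nat using (ℕ; zero; suc; _+_; _∸_; _≤_; _<_; z≤n; s≤s)
open import Data.Nat.ListAction using (sum)
open import Data.Nat.Properties
  using (+-commutativeSemigroup; <-cmp; +-mono-≤; ≤-reflexive; ≤-trans; <-irrefl; n≢0⇒n>0; m<1+n⇒m<n∨m≡n;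
         module ≤-Reasoning)
open import Data.Product using (∃; _×_; _,_; proj₁; proj₂)
open import Data.Sum using (_⊎_; inj₁; inj₂; [_,_]′)
open import Function using (_∘_; id)
open import Relation.Binary.Construct.Closure.ReflexiveTransitive using (ε; _◅_; _◅◅_; reverse)
open import Relation.Binary.Definitions using (tri<; tri≈; tri>)
open import Relation.Binary.PropositionalEquality
  using (_≡_; _≢_; refl; sym; trans; cong; cong₂; subst; module ≡-Reasoning)
open import Relation.Nullary using (¬_; does; yes; no; contradiction)
open import Relation.Nullary.Decidable using (dec-true; dec-false)

indicator : Bool → ℕ
indicator b = if b then 1 else 0

-- deg G D x unfolds to count (cadj G D x).
count : ∀ {n} → (Fin n → Bool) → ℕ
count {n} f = sum (map (indicator ∘ f) (allFin n))

_without_ : ∀ {n} → (Fin n → Bool) → Fin n → Fin n → Bool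
(f without p) y = not (does (y ≟ p)) ∧ f y

count-suc : ∀ {n} (f : Fin (suc n) → Bool) → count f ≡ indicator (f zero) + count (f ∘ suc)
count-suc f = cong (λ xs → indicator (f zero) + sum xs)
  (trans (map-tabulate suc (indicator ∘ f)) (sym (map-tabulate id (indicator ∘ f ∘ suc))))

count-without : ∀ {n} (f : Fin n → Bool) p → count f ≡ indicator (f p) + count (f without p)
count-without {suc n} f zero =
  trans (count-suc f) (cong (indicator (f zero) +_) (sym (count-suc (f without zero))))
count-without {suc n} f (suc p) = begin
  count f                                       ≡⟨ count-suc f ⟩
  a + count (f ∘ suc)                           ≡⟨ cong (a +_) (count-without (f ∘ suc) p) ⟩
  a + (b + count ((f ∘ suc) without p))         ≡⟨ x∙yz≈y∙xz +-commutativeSemigroup a b _ ⟩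
  b + (a + count ((f ∘ suc) without p))         ≡⟨ cong (b +_) (count-suc (f without suc p)) ⟨
  b + count (f without suc p)                   ∎
  where
  open ≡-Reasoning
  a = indicator (f zero)
  b = indicator (f (suc p))

count-false : ∀ {n} (f : Fin n → Bool) → (∀ y → f y ≡ false) → count f ≡ 0
count-false {zero} f all-false = refl
count-false {suc n} f all-false = begin
  count f                              ≡⟨ count-suc f ⟩
  indicator (f zero) + count (f ∘ suc) ≡⟨ cong₂ _+_ (cong indicator (all-false zero))
                                                    (count-false (f ∘ suc) (all-false ∘ suc)) ⟩
  0                                    ∎
  where open ≡-Reasoning

count>0⇒∃ : ∀ {n} (f : Fin n → Bool) → 0 < count f → ∃ λ y → f y ≡ true
count>0⇒∃ {suc n} f pos rewrite count-suc f with f zero in fz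
... | true = zero , fz
... | false with y , fy ← count>0⇒∃ (f ∘ suc) pos = suc y , fy

without-true : ∀ {n} {f : Fin n → Bool} {p y} → f y ≡ true → y ≢ p → (f without p) y ≡ true
without-true {p = p} {y} fy y≢p rewrite dec-false (y ≟ p) y≢p = fy

without-elim : ∀ {n} {f : Fin n → Bool} {p y} → (f without p) y ≡ true → f y ≡ true × y ≢ p
without-elim {f = f} {p} {y} h with y ≟ p | f y
... | no y≢p  | true = refl , y≢p

indicator≤1 : ∀ b → indicator b ≤ 1
indicator≤1 true  = s≤s z≤n
indicator≤1 false = z≤n

length≤count : ∀ {n} (f : Fin n → Bool) {ps} → Unique ps → All (λ y → f y ≡ true) ps → length ps ≤ count f
length≤count f [] [] = z≤n
length≤count f {p ∷ ps} (p∉ps ∷ unique) (fp ∷ fps) = begin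
  suc (length ps)                       ≤⟨ s≤s (length≤count (f without p) unique fps′) ⟩
  suc (count (f without p))             ≡⟨ cong (λ b → indicator b + count (f without p)) fp ⟨
  indicator (f p) + count (f without p) ≡⟨ count-without f p ⟨
  count f                               ∎
  where
  open ≤-Reasoning
  fps′ = All.zipWith (λ (p≢y , fy) → without-true {f = f} fy (p≢y ∘ sym)) (p∉ps , fps)

count≤length : ∀ {n} (f : Fin n → Bool) ps → (∀ {y} → f y ≡ true → y ∈ ps) → count f ≤ length ps
count≤length f [] covers = ≤-reflexive (count-false f never)
  where
  never : ∀ y → f y ≡ false
  never y with f y in fy
  ... | false = refl
  ... | true with () ← covers fy
count≤length f (p ∷ ps) covers = begin
  count f                               ≡⟨ count-without f p ⟩
  indicator (f p) + count (f without p) ≤⟨ +-mono-≤ (indicator≤1 (f p))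
                                                     (count≤length (f without p) ps covers′) ⟩
  suc (length ps)                       ∎
  where
  open ≤-Reasoning
  covers′ : ∀ {y} → (f without p) y ≡ true → y ∈ ps
  covers′ h with fy , y≢p ← without-elim {f = f} h with covers fy
  ... | here y≡p = ⊥-elim (y≢p y≡p)
  ... | there y∈ps = y∈ps

count≡0⇒false : ∀ {n} (f : Fin n → Bool) → count f ≡ 0 → ∀ y → f y ≡ false
count≡0⇒false f none y with f y in fy
... | false = refl
... | true with () ← subst (1 ≤_) none (length≤count f ([] ∷ []) (fy ∷ []))

InStep⇒deleted : ∀ {n} (run : Run n) (s : Fin (length run)) k {y} →
                 InStep run s y → toℕ s < k → isDel (take k run) y ≡ true
InStep⇒deleted ((u , v) ∷ run) zero (suc k) {y} (inj₁ y≡u) _ rewrite dec-true (y ≟ u) y≡u = refl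
InStep⇒deleted ((u , v) ∷ run) zero (suc k) {y} (inj₂ y≡v) _ rewrite dec-true (y ≟ v) y≡v =
  cong (_∨ isDel (take k run) y) (∨-zeroʳ (does (y ≟ u)))
InStep⇒deleted ((u , v) ∷ run) (suc s) (suc k) st (s≤s s<k) rewrite InStep⇒deleted run s k st s<k = ∨-zeroʳ _

deleted⇒InStep : ∀ {n} (run : Run n) k {y} → isDel (take k run) y ≡ true → ∃ λ s → toℕ s < k × InStep run s y
deleted⇒InStep ((u , v) ∷ run) (suc k) {y} del with y ≟ u | y ≟ v
... | yes y≡u | _       = zero , s≤s z≤n , inj₁ y≡u
... | no _    | yes y≡v = zero , s≤s z≤n , inj₂ y≡v
... | no _    | no _ with s , s<k , st ← deleted⇒InStep run k del = suc s , s≤s s<k , st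

uncovered⇒undeleted : ∀ {n} (run : Run n) {w} → ¬ CoveredM run w → ∀ k → isDel (take k run) w ≡ false
uncovered⇒undeleted run {w} uncovered k with isDel (take k run) w in del
... | false = refl
... | true with s , _ , st ← deleted⇒InStep run k del = contradiction (s , st) uncovered

adj⇒≢ : ∀ {n} (G : Graph n) {x y} → adj G x y ≡ true → x ≢ y
adj⇒≢ G {x} a refl = contradiction (trans (sym (irrefl G x)) a) λ ()

module _ {n} (G : Graph n) (D : Run n) where

  cadj-intro : ∀ {x y} → adj G x y ≡ true → isDel D x ≡ false → isDel D y ≡ false → cadj G D x y ≡ true
  cadj-intro a x-alive y-alive rewrite a | x-alive | y-alive = refl

  cadj-elim : ∀ {x y} → cadj G D x y ≡ true → adj G x y ≡ true × isDel D x ≡ false × isDel D y ≡ false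
  cadj-elim {x} {y} h with adj G x y | isDel D x | isDel D y
  ... | true  | false | false = refl , refl , refl
  ... | true  | false | true  = contradiction h λ ()
  ... | true  | true  | _     = contradiction h λ ()
  ... | false | _     | _     = contradiction h λ ()

  cadj-sym : ∀ x y → cadj G D x y ≡ cadj G D y x
  cadj-sym x y rewrite Graph.sym G x y with isDel D x | isDel D y
  ... | true  | true  = refl
  ... | true  | false = refl
  ... | false | true  = refl
  ... | false | false = refl

  adjacent⇒0<deg : ∀ {x y} → cadj G D x y ≡ true → 0 < deg G D x
  adjacent⇒0<deg h = length≤count (cadj G D _) ([] ∷ []) (h ∷ [])

module Greedy {n} (G : Graph n) (run : Run n) (valid : ValidRun G run)
              (L : List (Fin n × Fin n)) (L-matching : IsMatching G L) where

  open ValidRun valid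
  open DecMembership (_≟_ {n}) using (_∈?_)

  stepU stepV : Fin (length run) → Fin n
  stepU s = proj₁ (stepEdge run s)
  stepV s = proj₂ (stepEdge run s)

  step-adj : ∀ s → adj G (stepU s) (stepV s) ≡ true
  step-adj s = proj₁ (cadj-elim G (before run s) (edgeChosen s))

  step-undeleted : ∀ s {y} → InStep run s y → isDel (before run s) y ≡ false
  step-undeleted s (inj₁ refl) = proj₁ (proj₂ (cadj-elim G (before run s) (edgeChosen s)))
  step-undeleted s (inj₂ refl) = proj₂ (proj₂ (cadj-elim G (before run s) (edgeChosen s)))

  InStep-unique : ∀ {s s′ y} → InStep run s y → InStep run s′ y → s ≡ s′
  InStep-unique {s} {s′} y∈s y∈s′ with <-cmp (toℕ s) (toℕ s′)
  ... | tri< s<s′ _ _ = ⊥-elim (not-¬ (step-undeleted s′ y∈s′) (InStep⇒deleted run s (toℕ s′) y∈s s<s′))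
  ... | tri≈ _ s≡s′ _ = toℕ-injective s≡s′
  ... | tri> _ _ s′<s = ⊥-elim (not-¬ (step-undeleted s y∈s) (InStep⇒deleted run s′ (toℕ s) y∈s′ s′<s))

  InM⇒InStep : ∀ {x y} → InM run x y → ∃ λ s → InStep run s x × InStep run s y
  InM⇒InStep (inj₁ xy∈run) =
    index xy∈run , inj₁ (cong proj₁ (lookup-index xy∈run)) , inj₂ (cong proj₂ (lookup-index xy∈run))
  InM⇒InStep (inj₂ yx∈run) =
    index yx∈run , inj₂ (cong proj₂ (lookup-index yx∈run)) , inj₁ (cong proj₁ (lookup-index yx∈run))

  InM⇒adj : ∀ {x y} → InM run x y → adj G x y ≡ true
  InM⇒adj (inj₁ xy∈run) =
    subst (λ (x , y) → adj G x y ≡ true) (sym (lookup-index xy∈run)) (step-adj (index xy∈run))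
  InM⇒adj {x} {y} (inj₂ yx∈run) = trans (Graph.sym G x y) (InM⇒adj (inj₁ yx∈run))

  stepU-partner : ∀ {s z} → InM run (stepU s) z → z ≡ stepV s
  stepU-partner {s} uz with s′ , u∈s′ , z∈s′ ← InM⇒InStep uz
    with refl ← InStep-unique u∈s′ (inj₁ refl) with z∈s′
  ... | inj₁ z≡u = contradiction (sym z≡u) (adj⇒≢ G (InM⇒adj uz))
  ... | inj₂ z≡v = z≡v

  InMs⇒adj : ∀ {x y} → InMs L x y → adj G x y ≡ true
  InMs⇒adj (inj₁ xy∈L) = All.lookup (IsMatching.areEdges L-matching) xy∈L
  InMs⇒adj {x} {y} (inj₂ yx∈L) = trans (Graph.sym G x y) (InMs⇒adj (inj₁ yx∈L))

  InMs-sym : ∀ {x y} → InMs L x y → InMs L y x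
  InMs-sym (inj₁ xy∈L) = inj₂ xy∈L
  InMs-sym (inj₂ yx∈L) = inj₁ yx∈L

  InM-sym : ∀ {x y} → InM run x y → InM run y x
  InM-sym (inj₁ xy∈run) = inj₂ xy∈run
  InM-sym (inj₂ yx∈run) = inj₁ yx∈run

  InU-sym : ∀ {x y} → InU run L x y → InU run L y x
  InU-sym (inj₁ xy∈M) = inj₁ (InM-sym xy∈M)
  InU-sym (inj₂ xy∈Ms) = inj₂ (InMs-sym xy∈Ms)

  alternating-Ms-partner : ∀ {l} → StarAlt run L l → ∀ {y} → y ∈ l → ∃ λ x → InMs L y x × x ∈ l
  alternating-Ms-partner (lastEdge xy) (here refl) = _ , xy , there (here refl)
  alternating-Ms-partner (lastEdge xy) (there (here refl)) = _ , InMs-sym xy , here refl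
  alternating-Ms-partner (moreEdges xy _ _) (here refl) = _ , xy , there (here refl)
  alternating-Ms-partner (moreEdges xy _ _) (there (here refl)) = _ , InMs-sym xy , here refl
  alternating-Ms-partner (moreEdges _ _ rest) (there (there y∈)) with x , yx , x∈ ← alternating-Ms-partner rest y∈ =
    x , yx , there (there x∈)

  HasDistinctPartners : List (Fin n) → Fin n → Set
  HasDistinctPartners l y = ∃ λ x → ∃ λ z → InMs L y x × InM run y z × x ≢ z × x ∈ l

  alternating-inner : ∀ {l} → StarAlt run L l → Unique l → ∀ {y} → y ∈ l →
                      (∃ λ rest → l ≡ y ∷ rest) ⊎ (∃ λ pre → l ≡ pre ∷ʳ y) ⊎ HasDistinctPartners l y
  alternating-inner (lastEdge _) _ (here refl) = inj₁ (_ , refl)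
  alternating-inner (lastEdge {x} _) _ (there (here refl)) = inj₂ (inj₁ (x ∷ [] , refl))
  alternating-inner (moreEdges _ _ _) _ (here refl) = inj₁ (_ , refl)
  alternating-inner (moreEdges {z = z} xy yz _) (x∉ ∷ _) (there (here refl)) =
    inj₂ (inj₂ (_ , z , InMs-sym xy , yz , All.lookup x∉ (there (here refl)) , here refl))
  alternating-inner (moreEdges {x} {y} xy yz rest) (_ ∷ y∉ ∷ unique) (there (there z∈))
    with alternating-inner rest unique z∈
  ... | inj₁ (_ , refl) with w , zw , w∈ ← alternating-Ms-partner rest (here refl) =
    inj₂ (inj₂ (w , y , zw , InM-sym yz , All.lookup y∉ w∈ ∘ sym , there (there w∈)))
  ... | inj₂ (inj₁ (pre , l≡pre∷ʳz)) = inj₂ (inj₁ (x ∷ y ∷ pre , cong (λ l → x ∷ y ∷ l) l≡pre∷ʳz))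
  ... | inj₂ (inj₂ (a , b , za , zb , a≢b , a∈)) = inj₂ (inj₂ (a , b , za , zb , a≢b , there (there a∈)))

  endpoint∈ : (P : MMsPath run L) → ∀ {w} → IsEndpoint P w → w ∈ verts P
  endpoint∈ P (inj₁ refl) = here refl
  endpoint∈ P (inj₂ refl) = there (∈-++⁺ʳ (inner P) (here refl))

  endpoint-uncovered : (P : MMsPath run L) → ∀ {w} → IsEndpoint P w → ¬ CoveredM run w
  endpoint-uncovered P (inj₁ refl) = startFree P
  endpoint-uncovered P (inj₂ refl) = finishFree P

  start≢finish : (P : MMsPath run L) → start P ≢ finish P
  start≢finish P with start∉ ∷ _ ← distinct P = All.lookup start∉ (∈-++⁺ʳ (inner P) (here refl))

  covered⇒distinct-partners : (P : MMsPath run L) → ∀ {y} → y ∈ verts P → CoveredM run y →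
                              HasDistinctPartners (verts P) y
  covered⇒distinct-partners P y∈ covered with alternating-inner (alternating P) (distinct P) y∈
  ... | inj₁ (_ , refl) = contradiction covered (startFree P)
  ... | inj₂ (inj₁ (pre , verts≡pre∷ʳy)) = contradiction (subst (CoveredM run) finish≡y covered) (finishFree P)
    where finish≡y = sym (∷ʳ-injectiveʳ (start P ∷ inner P) pre verts≡pre∷ʳy)
  ... | inj₂ (inj₂ partners) = partners

  reach-step : ∀ {a s x} → InStep run s x → Reach run L a x → Reach run L a (stepU s) × Reach run L a (stepV s)
  reach-step {s = s} (inj₁ refl) reach-u = reach-u , reach-u ◅◅ (inj₁ (inj₁ (∈-lookup s)) ◅ ε)
  reach-step {s = s} (inj₂ refl) reach-v = reach-v ◅◅ (inj₁ (inj₂ (∈-lookup s)) ◅ ε) , reach-v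

  step-within : (P : MMsPath run L) → ∀ {x s} → x ∈ verts P → InStep run s x → EdgeWithin P s
  step-within P {x} x∈ x∈s with reach-u , reach-v ← reach-step x∈s (proj₂ (component P x) x∈) =
    proj₁ (component P _) reach-u , proj₁ (component P _) reach-v

  shared-vertex⇒⊆ : (P P′ : MMsPath run L) → ∀ {w x} →
                    w ∈ verts P → w ∈ verts P′ → x ∈ verts P → x ∈ verts P′
  shared-vertex⇒⊆ P P′ {w} {x} w∈P w∈P′ x∈P = proj₁ (component P′ x)
    (proj₂ (component P′ w) w∈P′ ◅◅ reverse InU-sym (proj₂ (component P w) w∈P) ◅◅
     proj₂ (component P x) x∈P)

  first-step-undeleted : (P : MMsPath run L) → ∀ {t} → IsFirstMStep P t →
                         ∀ {x} → x ∈ verts P → isDel (before run t) x ≡ false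
  first-step-undeleted P {t} (_ , none-earlier) {x} x∈ with isDel (before run t) x in del
  ... | false = refl
  ... | true with s , s<t , x∈s ← deleted⇒InStep run (toℕ t) del =
    contradiction (step-within P x∈ x∈s) (none-earlier s s<t)

  first-step-partner : (P : MMsPath run L) → ∀ {s} → IsFirstMStep P s →
                       ∃ λ x → x ∈ verts P × cadj G (before run s) (stepU s) x ≡ true × x ≢ stepV s
  first-step-partner P {s} first@((u∈ , _) , _)
    with x , z , ux , uz , x≢z , x∈ ← covered⇒distinct-partners P u∈ (s , inj₁ refl) =
    x , x∈ ,
    cadj-intro G (before run s) (InMs⇒adj ux) (step-undeleted s (inj₁ refl)) (first-step-undeleted P first x∈) ,
    λ x≡v → x≢z (trans x≡v (sym (stepU-partner uz)))

  isolated-neighbours-deleted : ∀ s {w} → ¬ CoveredM run w → deg G (after run s) w ≡ 0 →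
                                ∀ {y} → cadj G (before run s) w y ≡ true → InStep run s y
  isolated-neighbours-deleted s uncovered isolated {y} wy
    with wy-adj , _ , y-alive ← cadj-elim G (before run s) wy
    with isDel (after run s) y in y-gone
  ... | false = ⊥-elim (not-¬ (count≡0⇒false _ isolated y) (cadj-intro G (after run s) wy-adj w-alive y-gone))
    where w-alive = uncovered⇒undeleted run uncovered (suc (toℕ s))
  ... | true with s′ , s′≤s , y∈s′ ← deleted⇒InStep run (suc (toℕ s)) y-gone with m<1+n⇒m<n∨m≡n s′≤s
  ...   | inj₁ s′<s = ⊥-elim (not-¬ y-alive (InStep⇒deleted run s′ (toℕ s) y∈s′ s′<s))
  ...   | inj₂ s′≡s = subst (λ s → InStep run s y) (toℕ-injective s′≡s) y∈s′

  chosen-neighbours⊆ : ∀ s {d} → d ≢ stepV s → 0 < deg G (before run s) d →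
                       (∀ {y} → cadj G (before run s) d y ≡ true → InStep run s y) →
                       ∀ {c} → cadj G (before run s) (stepU s) c ≡ true → c ≡ stepV s ⊎ c ≡ d
  chosen-neighbours⊆ s {d} d≢v d-active N[d]⊆step {c} uc with c ≟ stepV s | c ≟ d
  ... | yes c≡v | _       = inj₁ c≡v
  ... | no _    | yes c≡d = inj₂ c≡d
  ... | no c≢v  | no c≢d with cadj G (before run s) d (stepU s) in du
  ...   | true  = ⊥-elim (<-irrefl refl (≤-trans (≤-trans deg-u≥3 (minDegree s d d-active)) deg-d≤2))
    where
    D = before run s
    ud = trans (cadj-sym G D (stepU s) d) du
    deg-u≥3 : 3 ≤ deg G D (stepU s)
    deg-u≥3 = length≤count (cadj G D (stepU s)) ((c≢v ∘ sym ∷ d≢v ∘ sym ∷ []) ∷ (c≢d ∷ []) ∷ [] ∷ [])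
                           (edgeChosen s ∷ uc ∷ ud ∷ [])
    deg-d≤2 : deg G D d ≤ 2
    deg-d≤2 = count≤length (cadj G D d) (stepU s ∷ stepV s ∷ [])
                           λ dy → [ here , there ∘ here ]′ (N[d]⊆step dy)
  ...   | false = ⊥-elim (<-irrefl refl (≤-trans (≤-trans deg-u≥2 (minDegree s d d-active)) deg-d≤1))
    where
    D = before run s
    deg-u≥2 : 2 ≤ deg G D (stepU s)
    deg-u≥2 = length≤count (cadj G D (stepU s)) ((c≢v ∘ sym ∷ []) ∷ [] ∷ []) (edgeChosen s ∷ uc ∷ [])
    only-v : ∀ {y} → cadj G D d y ≡ true → y ∈ stepV s ∷ []
    only-v dy with N[d]⊆step dy
    ... | inj₁ refl = ⊥-elim (not-¬ du dy)
    ... | inj₂ y≡v = here y≡v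
    deg-d≤1 : deg G D d ≤ 1
    deg-d≤1 = count≤length (cadj G D d) (stepV s ∷ []) only-v

  not-isolated-by-step : ∀ s {x d} → cadj G (before run s) (stepU s) x ≡ true → x ≢ stepV s → x ≢ d →
                         ¬ CoveredM run d → 0 < deg G (before run s) d → deg G (after run s) d ≢ 0
  not-isolated-by-step s ux x≢v x≢d uncovered d-active isolated = [ x≢v , x≢d ]′
    (chosen-neighbours⊆ s (λ d≡v → uncovered (s , inj₂ d≡v)) d-active
                        (isolated-neighbours-deleted s uncovered isolated) ux)

  endpoint-active : (P : MMsPath run L) → ∀ {t w} → IsFirstMStep P t → IsEndpoint P w → 0 < deg G (before run t) w
  endpoint-active P {t} first ep with w′ , ww′ , w′∈ ← alternating-Ms-partner (alternating P) (endpoint∈ P ep) =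
    adjacent⇒0<deg G (before run t) (cadj-intro G (before run t) (InMs⇒adj ww′)
      (uncovered⇒undeleted run (endpoint-uncovered P ep) (toℕ t)) (first-step-undeleted P first w′∈))

  first-step-leaves-endpoint : (P : MMsPath run L) → ∀ {t} → IsFirstMStep P t →
                               ∃ λ w → IsEndpoint P w × 0 < deg G (after run t) w
  first-step-leaves-endpoint P {t} first with x , _ , ux , x≢v ← first-step-partner P first with x ≟ start P
  ... | yes x≡a = finish P , inj₂ refl , n≢0⇒n>0 (not-isolated-by-step t ux x≢v
    (start≢finish P ∘ trans (sym x≡a)) (finishFree P) (endpoint-active P first (inj₂ refl)))
  ... | no x≢a = start P , inj₁ refl , n≢0⇒n>0 (not-isolated-by-step t ux x≢v
    x≢a (startFree P) (endpoint-active P first (inj₁ refl)))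

  isolating-step-not-first : (P : MMsPath run L) → ∀ {t} → IsFirstMStep P t → ∀ {w} → IsEndpoint P w →
    ∀ s → toℕ t < toℕ s → 0 < deg G (before run s) w → deg G (after run s) w ≡ 0 →
    ∀ P′ → ¬ IsFirstMStep P′ s
  isolating-step-not-first P {t} first {w} ep s t<s w-active isolated P′ first′ with w ∈? verts P′
  ... | yes w∈P′ = proj₂ first′ t t<s (P⊆P′ (proj₁ (proj₁ first)) , P⊆P′ (proj₂ (proj₁ first)))
    where
    P⊆P′ : ∀ {x} → x ∈ verts P → x ∈ verts P′
    P⊆P′ = shared-vertex⇒⊆ P P′ (endpoint∈ P ep) w∈P′
  ... | no w∉P′ with x , x∈P′ , ux , x≢v ← first-step-partner P′ first′ =
    not-isolated-by-step s ux x≢v (λ x≡w → w∉P′ (subst (_∈ verts P′) x≡w x∈P′))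
                         (endpoint-uncovered P ep) w-active isolated

  isolated-endpoint-transfer : (Δ : ℕ) (P : MMsPath run L) → ∀ {t} → IsFirstMStep P t → ∀ {w} → IsEndpoint P w →
    ∀ s → toℕ t < toℕ s → 0 < deg G (before run s) w → deg G (after run s) w ≡ 0 →
    (∀ y → InMs L w y → cadj G (before run s) w y ≡ false) →
    ∃ λ v → cadj G (before run s) v w ≡ true × DirectTransfer G Δ run L v w
  isolated-endpoint-transfer Δ P first ep s t<s w-active isolated no-Ms-edge
    with y , wy ← count>0⇒∃ (cadj G (before run s) _) w-active =
    y , yw , (proj₁ (cadj-elim G (before run s) yw) , y∉M , y∉Ms) , (s , y∈s) , (P , ep) ,
    (s , y∈s , isolating-step-not-first P first ep s t<s w-active isolated , subst (_≤ Δ ∸ 2) (sym isolated) z≤n)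
    where
    uncovered = endpoint-uncovered P ep
    y∈s = isolated-neighbours-deleted s uncovered isolated wy
    yw = trans (cadj-sym G (before run s) y _) wy
    y∉M : ¬ InM run y _
    y∉M yw∈M with s′ , _ , w∈s′ ← InM⇒InStep yw∈M = uncovered (s′ , w∈s′)
    y∉Ms : ¬ InMs L y _
    y∉Ms yw∈Ms = not-¬ (no-Ms-edge y (InMs-sym yw∈Ms)) wy

lemma5 : ∀ {n} (G : Graph n) (Δ : ℕ) → 4 ≤ Δ → (∀ x → deg G [] x ≤ Δ) →
         (run : Run n) → ValidRun G run →
         (L : List (Fin n × Fin n)) → IsMaximumMatching G L →
         ComponentStructure run L →
         (P : MMsPath run L) → (t : Fin (length run)) → IsFirstMStep P t →
         (∃ λ w → IsEndpoint P w × 0 < deg G (after run t) w) ×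
         (∀ w → IsEndpoint P w → 0 < deg G (after run t) w →
            (s : Fin (length run)) → toℕ t < toℕ s →
            0 < deg G (before run s) w → deg G (after run s) w ≡ 0 →
            (∀ y → InMs L w y → cadj G (before run s) w y ≡ false) →
            ∃ λ v → cadj G (before run s) v w ≡ true × DirectTransfer G Δ run L v w)
lemma5 G Δ _ _ run valid L (L-matching , _) _ P t first =
  first-step-leaves-endpoint P first , λ w endpoint _ → isolated-endpoint-transfer Δ P first endpoint
  where open Greedy G run valid L L-matching
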